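{- For all $\varphi\in\mathcal{L}_{Full}$: if $\mathsf{Full}\vdash\varphi$ then $\mathsf{Par}\vdash\varphi^{par}$.
   Context: Fix countable $\mathsf{P}_0$, $\mathsf{G}_0$. $\mathcal{L}_{Par}$: $\varphi ::= p \mid \neg\varphi \mid \varphi\lor\varphi \mid \langle\gamma\rangle\varphi$, $\gamma ::= g \mid \gamma;\gamma \mid \gamma\sqcup\gamma \mid \gamma^* \mid \gamma^d \mid \varphi?$. $\mathcal{L}_{Full}$: $\varphi ::= p \mid \neg\varphi \mid \varphi\lor\varphi \mid \langle\gamma\rangle\varphi$, $\gamma ::= g \mid \gamma;\gamma \mid \gamma\sqcup\gamma \mid \gamma\sqcap\gamma \mid \gamma^* \mid \gamma^\times \mid \gamma^d \mid \varphi? \mid \varphi!$, with $\land,\to,\leftrightarrow$ abbreviations. Translation $(\cdot)^{par}:\mathcal{L}_{Full}\to\mathcal{L}_{Par}$: $p^{par}=p$, $(\neg\varphi)^{par}=\neg\varphi^{par}$, $(\varphi\lor\psi)^{par}=\varphi^{par}\lor\psi^{par}$, $(\langle\gamma\rangle\varphi)^{par}=\langle\gamma^{par}\rangle\varphi^{par}$; $g^{par}=g$, $(\gamma^d)^{par}=(\gamma^{par})^d$, $(\gamma\sqcup\delta)^{par}=\gamma^{par}\sqcup\delta^{par}$, $(\gamma\sqcap\delta)^{par}=((\gamma^{par})^d\sqcup(\delta^{par})^d)^d$, $(\gamma;\delta)^{par}=\gamma^{par};\delta^{par}$, $(\gamma^*)^{par}=(\gamma^{par})^*$, $(\gamma^\times)^{par}=(((\gamma^{par})^d)^*)^d$,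 $(\varphi?)^{par}=\varphi^{par}?$, $(\varphi!)^{par}=((\neg\varphi^{par})?)^d$. $\mathsf{Par}$: Hilbert system over $\mathcal{L}_{Par}$ with axioms propositional tautologies, $\langle\gamma;\delta\rangle\varphi\leftrightarrow\langle\gamma\rangle\langle\delta\rangle\varphi$, $\langle\gamma\sqcup\delta\rangle\varphi\leftrightarrow\langle\gamma\rangle\varphi\lor\langle\delta\rangle\varphi$, $\langle\gamma^*\rangle\varphi\leftrightarrow\varphi\lor\langle\gamma\rangle\langle\gamma^*\rangle\varphi$, $\langle\psi?\rangle\varphi\leftrightarrow\psi\land\varphi$, $\langle\gamma^d\rangle\varphi\leftrightarrow\neg\langle\gamma\rangle\neg\varphi$, and rules modus ponens, monotonicity (from $\varphi\to\psi$ infer $\langle\gamma\rangle\varphi\to\langle\gamma\rangle\psi$), bar induction (from $\langle\gamma\rangle\varphi\to\varphi$ infer $\langle\gamma^*\rangle\varphi\to\varphi$). $\mathsf{Full}$: the same axioms/rules over $\mathcal{L}_{Full}$ plus axioms $\langle\gamma\sqcap\delta\rangle\varphi\leftrightarrow\langle\gamma\rangle\varphi\land\langle\delta\rangle\varphi$, $\langle\gamma^\times\rangle\varphi\leftrightarrow\varphi\land\langle\gamma\rangle\langle\gamma^\times\rangle\varphi$, $\langle\psi!\rangle\varphi\leftrightarrow\psi\lor\varphi$, and rule: from $\varphi\to\langle\gamma\rangle\varphi$ infer $\varphi\to\langle\gamma^\times\rangle\varphi$. -}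

module Defs where

open import Data.Nat using (ℕ)
open import Data.Bool using (Bool; true; false; not; _∨_)
open import Relation.Binary.PropositionalEquality using (_≡_)

-- Atomic propositions P₀ and atomic games G₀ are both taken to be ℕ
-- (countable, as fixed in the paper).

mutual
  data FmP : Set where
    atP  : ℕ → FmP
    ¬P_  : FmP → FmP
    _∨P_ : FmP → FmP → FmP
    ⟨_⟩P_ : GmP → FmP → FmP

  data GmP : Set where
    gP    : ℕ → GmP
    _⨾P_  : GmP → GmP → GmP
    _⊔P_  : GmP → GmP → GmP
    _*P   : GmP → GmP
    _ᵈP   : GmP → GmP
    _?P   : FmP → GmP

mutual
  data FmF : Set where
    atF  : ℕ → FmF
    ¬F_  : FmF → FmF
    _∨F_ : FmF → FmF → FmF
    ⟨_⟩F_ : GmF → FmF → FmF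

  data GmF : Set where
    gF    : ℕ → GmF
    _⨾F_  : GmF → GmF → GmF
    _⊔F_  : GmF → GmF → GmF
    _⊓F_  : GmF → GmF → GmF
    _*F   : GmF → GmF
    _×F   : GmF → GmF
    _ᵈF   : GmF → GmF
    _?F   : FmF → GmF
    _!F   : FmF → GmF

_∧P_ : FmP → FmP → FmP
φ ∧P ψ = ¬P ((¬P φ) ∨P (¬P ψ))

_⇒P_ : FmP → FmP → FmP
φ ⇒P ψ = (¬P φ) ∨P ψ

_⇔P_ : FmP → FmP → FmP
φ ⇔P ψ = (φ ⇒P ψ) ∧P (ψ ⇒P φ)

_∧F_ : FmF → FmF → FmF
φ ∧F ψ = ¬F ((¬F φ) ∨F (¬F ψ))

_⇒F_ : FmF → FmF → FmF
φ ⇒F ψ = (¬F φ) ∨F ψ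

_⇔F_ : FmF → FmF → FmF
φ ⇔F ψ = (φ ⇒F ψ) ∧F (ψ ⇒F φ)

-- Propositional tautologies: a formula is a tautology if it is true under
-- every Boolean assignment to its propositional atoms and to its modal
-- subformulas ⟨γ⟩φ (treated as propositional atoms).

evalP : (ℕ → Bool) → (GmP → FmP → Bool) → FmP → Bool
evalP v w (atP p)    = v p
evalP v w (¬P φ)     = not (evalP v w φ)
evalP v w (φ ∨P ψ)   = evalP v w φ ∨ evalP v w ψ
evalP v w (⟨ γ ⟩P φ) = w γ φ

TautP : FmP → Set
TautP φ = ∀ v w → evalP v w φ ≡ true


evalF : (ℕ → Bool) → (GmF → FmF → Bool) → FmF → Bool
evalF v w (atF p)    = v p
evalF v w (¬F φ)     = not (evalF v w φ)
evalF v w (φ ∨F ψ)   = evalF v w φ ∨ evalF v w ψ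
evalF v w (⟨ γ ⟩F φ) = w γ φ

TautF : FmF → Set
TautF φ = ∀ v w → evalF v w φ ≡ true


data ⊢Par : FmP → Set where
  taut   : ∀ {φ} → TautP φ → ⊢Par φ
  ax-seq : ∀ γ δ φ → ⊢Par ((⟨ γ ⨾P δ ⟩P φ) ⇔P (⟨ γ ⟩P (⟨ δ ⟩P φ)))
  ax-cho : ∀ γ δ φ → ⊢Par ((⟨ γ ⊔P δ ⟩P φ) ⇔P ((⟨ γ ⟩P φ) ∨P (⟨ δ ⟩P φ)))
  ax-it  : ∀ γ φ → ⊢Par ((⟨ γ *P ⟩P φ) ⇔P (φ ∨P (⟨ γ ⟩P (⟨ γ *P ⟩P φ))))
  ax-tst : ∀ ψ φ → ⊢Par ((⟨ ψ ?P ⟩P φ) ⇔P (ψ ∧P φ))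
  ax-dual : ∀ γ φ → ⊢Par ((⟨ γ ᵈP ⟩P φ) ⇔P (¬P (⟨ γ ⟩P (¬P φ))))
  mp     : ∀ {φ ψ} → ⊢Par (φ ⇒P ψ) → ⊢Par φ → ⊢Par ψ
  mono   : ∀ {φ ψ} γ → ⊢Par (φ ⇒P ψ) → ⊢Par ((⟨ γ ⟩P φ) ⇒P (⟨ γ ⟩P ψ))
  bar    : ∀ {φ} γ → ⊢Par ((⟨ γ ⟩P φ) ⇒P φ) → ⊢Par ((⟨ γ *P ⟩P φ) ⇒P φ)

data ⊢Full : FmF → Set where
  taut   : ∀ {φ} → TautF φ → ⊢Full φ
  ax-seq : ∀ γ δ φ → ⊢Full ((⟨ γ ⨾F δ ⟩F φ) ⇔F (⟨ γ ⟩F (⟨ δ ⟩F φ)))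
  ax-cho : ∀ γ δ φ → ⊢Full ((⟨ γ ⊔F δ ⟩F φ) ⇔F ((⟨ γ ⟩F φ) ∨F (⟨ δ ⟩F φ)))
  ax-it  : ∀ γ φ → ⊢Full ((⟨ γ *F ⟩F φ) ⇔F (φ ∨F (⟨ γ ⟩F (⟨ γ *F ⟩F φ))))
  ax-tst : ∀ ψ φ → ⊢Full ((⟨ ψ ?F ⟩F φ) ⇔F (ψ ∧F φ))
  ax-dual : ∀ γ φ → ⊢Full ((⟨ γ ᵈF ⟩F φ) ⇔F (¬F (⟨ γ ⟩F (¬F φ))))
  ax-dch : ∀ γ δ φ → ⊢Full ((⟨ γ ⊓F δ ⟩F φ) ⇔F ((⟨ γ ⟩F φ) ∧F (⟨ δ ⟩F φ)))
  ax-dit : ∀ γ φ → ⊢Full ((⟨ γ ×F ⟩F φ) ⇔F (φ ∧F (⟨ γ ⟩F (⟨ γ ×F ⟩F φ))))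
  ax-dtst : ∀ ψ φ → ⊢Full ((⟨ ψ !F ⟩F φ) ⇔F (ψ ∨F φ))
  mp     : ∀ {φ ψ} → ⊢Full (φ ⇒F ψ) → ⊢Full φ → ⊢Full ψ
  mono   : ∀ {φ ψ} γ → ⊢Full (φ ⇒F ψ) → ⊢Full ((⟨ γ ⟩F φ) ⇒F (⟨ γ ⟩F ψ))
  bar    : ∀ {φ} γ → ⊢Full ((⟨ γ ⟩F φ) ⇒F φ) → ⊢Full ((⟨ γ *F ⟩F φ) ⇒F φ)
  dbar   : ∀ {φ} γ → ⊢Full (φ ⇒F (⟨ γ ⟩F φ)) → ⊢Full (φ ⇒F (⟨ γ ×F ⟩F φ))

mutual
  parF : FmF → FmP
  parF (atF p)    = atP p
  parF (¬F φ)     = ¬P (parF φ)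
  parF (φ ∨F ψ)   = parF φ ∨P parF ψ
  parF (⟨ γ ⟩F φ) = ⟨ parG γ ⟩P (parF φ)

  parG : GmF → GmP
  parG (gF g)    = gP g
  parG (γ ⨾F δ)  = parG γ ⨾P parG δ
  parG (γ ⊔F δ)  = parG γ ⊔P parG δ
  parG (γ ⊓F δ)  = ((parG γ ᵈP) ⊔P (parG δ ᵈP)) ᵈP
  parG (γ *F)    = parG γ *P
  parG (γ ×F)    = ((parG γ ᵈP) *P) ᵈP
  parG (γ ᵈF)    = parG γ ᵈP
  parG (φ ?F)    = parF φ ?P
  parG (φ !F)    = ((¬P (parF φ)) ?P) ᵈP

module Submission where

-- The translation commutes with the propositional connectives, so tautologies
-- go to tautologies, and ⊓, ×, ! become the dual abbreviations ⊓P, ×P, !P.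
-- Every Full axiom then translates to a Par axiom or to a Par theorem obtained
-- by pushing duals through negations, and every rule to the same Par rule,
-- except ×-induction, which is bar induction for γᵈ read contrapositively.

open import Defs
open import Data.Nat using (ℕ; zero; suc)
open import Data.Fin using (Fin; zero; suc)
open import Data.Bool using (Bool; true; false; not; _∨_; _∧_)
open import Data.Vec using (Vec; []; _∷_; lookup; map)
open import Data.Vec.Properties using (lookup-map)
open import Relation.Binary.Bundles using (Setoid)
open import Relation.Binary.PropositionalEquality using (_≡_; refl; sym; trans; cong; cong₂)
import Relation.Binary.Reasoning.Setoid as SetoidReasoning

data Prop (n : ℕ) : Set where
  var  : Fin n → Prop n
  ¬′_  : Prop n → Prop n
  _∨′_ : Prop n → Prop n → Prop n

pattern x₀ = var zero
pattern x₁ = var (suc zero)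
pattern x₂ = var (suc (suc zero))
pattern x₃ = var (suc (suc (suc zero)))

module _ {n : ℕ} where

  _⇒′_ _∧′_ _⇔′_ : Prop n → Prop n → Prop n
  a ⇒′ b = (¬′ a) ∨′ b
  a ∧′ b = ¬′ ((¬′ a) ∨′ (¬′ b))
  a ⇔′ b = (a ⇒′ b) ∧′ (b ⇒′ a)

  _[_] : Prop n → Vec FmP n → FmP
  var i    [ σ ] = lookup σ i
  (¬′ a)   [ σ ] = ¬P (a [ σ ])
  (a ∨′ b) [ σ ] = (a [ σ ]) ∨P (b [ σ ])

  ⟦_⟧ : Prop n → Vec Bool n → Bool
  ⟦ var i ⟧  ρ = lookup ρ i
  ⟦ ¬′ a ⟧   ρ = not (⟦ a ⟧ ρ)
  ⟦ a ∨′ b ⟧ ρ = ⟦ a ⟧ ρ ∨ ⟦ b ⟧ ρ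

  evalP-[] : ∀ v w (a : Prop n) σ → evalP v w (a [ σ ]) ≡ ⟦ a ⟧ (map (evalP v w) σ)
  evalP-[] v w (var i)  σ = sym (lookup-map i (evalP v w) σ)
  evalP-[] v w (¬′ a)   σ = cong not (evalP-[] v w a σ)
  evalP-[] v w (a ∨′ b) σ = cong₂ _∨_ (evalP-[] v w a σ) (evalP-[] v w b σ)

allAssignments : ∀ {n} → (Vec Bool n → Bool) → Bool
allAssignments {zero}  f = f []
allAssignments {suc n} f = allAssignments (λ ρ → f (true ∷ ρ)) ∧ allAssignments (λ ρ → f (false ∷ ρ))

allAssignments-sound : ∀ {n} (f : Vec Bool n → Bool) → allAssignments f ≡ true → ∀ ρ → f ρ ≡ true
allAssignments-sound {zero}  f h []          = h
allAssignments-sound {suc n} f h (b ∷ ρ) with allAssignments (λ ρ → f (true ∷ ρ)) in t | b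
... | true  | true  = allAssignments-sound _ t ρ
... | true  | false = allAssignments-sound _ h ρ
... | false | _     with () ← h

tautology : ∀ {n} (a : Prop n) → allAssignments ⟦ a ⟧ ≡ true → ∀ σ → ⊢Par (a [ σ ])
tautology a h σ = taut λ v w → trans (evalP-[] v w a σ) (allAssignments-sound ⟦ a ⟧ h _)

⇒-refl : ∀ {a} → ⊢Par (a ⇒P a)
⇒-refl {a} = tautology (x₀ ⇒′ x₀) refl (a ∷ [])

⇒-trans : ∀ {a b c} → ⊢Par (a ⇒P b) → ⊢Par (b ⇒P c) → ⊢Par (a ⇒P c)
⇒-trans {a} {b} {c} p q = mp (mp (tautology ((x₀ ⇒′ x₁) ⇒′ ((x₁ ⇒′ x₂) ⇒′ (x₀ ⇒′ x₂))) refl (a ∷ b ∷ c ∷ [])) p) q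

contraposition : ∀ {a b} → ⊢Par (a ⇒P b) → ⊢Par ((¬P b) ⇒P (¬P a))
contraposition {a} {b} = mp (tautology ((x₀ ⇒′ x₁) ⇒′ ((¬′ x₁) ⇒′ (¬′ x₀))) refl (a ∷ b ∷ []))

∨-mono : ∀ {a b c d} → ⊢Par (a ⇒P b) → ⊢Par (c ⇒P d) → ⊢Par ((a ∨P c) ⇒P (b ∨P d))
∨-mono {a} {b} {c} {d} p q = mp (mp (tautology ((x₀ ⇒′ x₁) ⇒′ ((x₂ ⇒′ x₃) ⇒′ ((x₀ ∨′ x₂) ⇒′ (x₁ ∨′ x₃)))) refl (a ∷ b ∷ c ∷ d ∷ [])) p) q

⇔-intro : ∀ {a b} → ⊢Par (a ⇒P b) → ⊢Par (b ⇒P a) → ⊢Par (a ⇔P b)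
⇔-intro {a} {b} p q = mp (mp (tautology ((x₀ ⇒′ x₁) ⇒′ ((x₁ ⇒′ x₀) ⇒′ (x₀ ⇔′ x₁))) refl (a ∷ b ∷ [])) p) q

⇔-elimˡ : ∀ {a b} → ⊢Par (a ⇔P b) → ⊢Par (a ⇒P b)
⇔-elimˡ {a} {b} = mp (tautology ((x₀ ⇔′ x₁) ⇒′ (x₀ ⇒′ x₁)) refl (a ∷ b ∷ []))

⇔-elimʳ : ∀ {a b} → ⊢Par (a ⇔P b) → ⊢Par (b ⇒P a)
⇔-elimʳ {a} {b} = mp (tautology ((x₀ ⇔′ x₁) ⇒′ (x₁ ⇒′ x₀)) refl (a ∷ b ∷ []))

¬¬-equiv : ∀ a → ⊢Par ((¬P (¬P a)) ⇔P a)
¬¬-equiv a = tautology ((¬′ (¬′ x₀)) ⇔′ x₀) refl (a ∷ [])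

⇔-setoid : Setoid _ _
⇔-setoid = record
  { Carrier       = FmP
  ; _≈_           = λ a b → ⊢Par (a ⇔P b)
  ; isEquivalence = record
    { refl  = ⇔-intro ⇒-refl ⇒-refl
    ; sym   = λ p → ⇔-intro (⇔-elimʳ p) (⇔-elimˡ p)
    ; trans = λ p q → ⇔-intro (⇒-trans (⇔-elimˡ p) (⇔-elimˡ q)) (⇒-trans (⇔-elimʳ q) (⇔-elimʳ p))
    }
  }

open Setoid ⇔-setoid using () renaming (refl to ⇔-refl)
open SetoidReasoning ⇔-setoid

¬-cong : ∀ {a b} → ⊢Par (a ⇔P b) → ⊢Par ((¬P a) ⇔P (¬P b))
¬-cong p = ⇔-intro (contraposition (⇔-elimʳ p)) (contraposition (⇔-elimˡ p))

⟨⟩-cong : ∀ {a b} γ → ⊢Par (a ⇔P b) → ⊢Par ((⟨ γ ⟩P a) ⇔P (⟨ γ ⟩P b))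
⟨⟩-cong γ p = ⇔-intro (mono γ (⇔-elimˡ p)) (mono γ (⇔-elimʳ p))

∨-cong : ∀ {a b c d} → ⊢Par (a ⇔P b) → ⊢Par (c ⇔P d) → ⊢Par ((a ∨P c) ⇔P (b ∨P d))
∨-cong p q = ⇔-intro (∨-mono (⇔-elimˡ p) (⇔-elimˡ q)) (∨-mono (⇔-elimʳ p) (⇔-elimʳ q))

ᵈ-¬ : ∀ γ φ → ⊢Par ((⟨ γ ᵈP ⟩P (¬P φ)) ⇔P (¬P (⟨ γ ⟩P φ)))
ᵈ-¬ γ φ = begin
  ⟨ γ ᵈP ⟩P (¬P φ)          ≈⟨ ax-dual γ (¬P φ) ⟩
  ¬P (⟨ γ ⟩P (¬P (¬P φ)))   ≈⟨ ¬-cong (⟨⟩-cong γ (¬¬-equiv φ)) ⟩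
  ¬P (⟨ γ ⟩P φ)             ∎

_⊓P_ : GmP → GmP → GmP
γ ⊓P δ = ((γ ᵈP) ⊔P (δ ᵈP)) ᵈP

_×P : GmP → GmP
γ ×P = ((γ ᵈP) *P) ᵈP

_!P : FmP → GmP
ψ !P = ((¬P ψ) ?P) ᵈP

⊓-axiom : ∀ γ δ φ → ⊢Par ((⟨ γ ⊓P δ ⟩P φ) ⇔P ((⟨ γ ⟩P φ) ∧P (⟨ δ ⟩P φ)))
⊓-axiom γ δ φ = begin
  ⟨ γ ⊓P δ ⟩P φ                                     ≈⟨ ax-dual _ φ ⟩
  ¬P (⟨ (γ ᵈP) ⊔P (δ ᵈP) ⟩P (¬P φ))                 ≈⟨ ¬-cong (ax-cho _ _ (¬P φ)) ⟩
  ¬P ((⟨ γ ᵈP ⟩P (¬P φ)) ∨P (⟨ δ ᵈP ⟩P (¬P φ)))     ≈⟨ ¬-cong (∨-cong (ᵈ-¬ γ φ) (ᵈ-¬ δ φ)) ⟩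
  ¬P ((¬P (⟨ γ ⟩P φ)) ∨P (¬P (⟨ δ ⟩P φ)))           ∎

×-axiom : ∀ γ φ → ⊢Par ((⟨ γ ×P ⟩P φ) ⇔P (φ ∧P (⟨ γ ⟩P (⟨ γ ×P ⟩P φ))))
×-axiom γ φ = begin
  ⟨ γ ×P ⟩P φ                                       ≈⟨ ax-dual _ φ ⟩
  ¬P X                                              ≈⟨ ¬-cong (ax-it (γ ᵈP) (¬P φ)) ⟩
  ¬P ((¬P φ) ∨P (⟨ γ ᵈP ⟩P X))                      ≈⟨ ¬-cong (∨-cong ⇔-refl (ax-dual γ X)) ⟩
  ¬P ((¬P φ) ∨P (¬P (⟨ γ ⟩P (¬P X))))               ≈⟨ ¬-cong (∨-cong ⇔-refl (¬-cong (⟨⟩-cong γ (ax-dual _ φ)))) ⟨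
  ¬P ((¬P φ) ∨P (¬P (⟨ γ ⟩P (⟨ γ ×P ⟩P φ))))        ∎
  where X = ⟨ (γ ᵈP) *P ⟩P (¬P φ)

!-axiom : ∀ ψ φ → ⊢Par ((⟨ ψ !P ⟩P φ) ⇔P (ψ ∨P φ))
!-axiom ψ φ = begin
  ⟨ ψ !P ⟩P φ                                       ≈⟨ ax-dual _ φ ⟩
  ¬P (⟨ (¬P ψ) ?P ⟩P (¬P φ))                        ≈⟨ ¬-cong (ax-tst (¬P ψ) (¬P φ)) ⟩
  ¬P ((¬P ψ) ∧P (¬P φ))                             ≈⟨ ¬¬-equiv _ ⟩
  (¬P (¬P ψ)) ∨P (¬P (¬P φ))                        ≈⟨ ∨-cong (¬¬-equiv ψ) (¬¬-equiv φ) ⟩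
  ψ ∨P φ                                            ∎

×-induction : ∀ {φ} γ → ⊢Par (φ ⇒P (⟨ γ ⟩P φ)) → ⊢Par (φ ⇒P (⟨ γ ×P ⟩P φ))
×-induction {φ} γ h =
  ⇒-trans (⇔-elimʳ (¬¬-equiv φ))
    (⇒-trans (contraposition (bar (γ ᵈP) step)) (⇔-elimʳ (ax-dual _ φ)))
  where
  step : ⊢Par ((⟨ γ ᵈP ⟩P (¬P φ)) ⇒P (¬P φ))
  step = ⇒-trans (⇔-elimˡ (ᵈ-¬ γ φ)) (contraposition h)

evalP-parF : ∀ v w φ → evalP v w (parF φ) ≡ evalF v (λ γ ψ → w (parG γ) (parF ψ)) φ
evalP-parF v w (atF p)    = refl
evalP-parF v w (¬F φ)     = cong not (evalP-parF v w φ)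
evalP-parF v w (φ ∨F ψ)   = cong₂ _∨_ (evalP-parF v w φ) (evalP-parF v w ψ)
evalP-parF v w (⟨ γ ⟩F φ) = refl

parF-taut : ∀ φ → TautF φ → TautP (parF φ)
parF-taut φ t v w = trans (evalP-parF v w φ) (t v _)

lemma16 : (φ : FmF) → ⊢Full φ → ⊢Par (parF φ)
lemma16 φ (taut t)        = taut (parF-taut φ t)
lemma16 _ (ax-seq γ δ φ)  = ax-seq (parG γ) (parG δ) (parF φ)
lemma16 _ (ax-cho γ δ φ)  = ax-cho (parG γ) (parG δ) (parF φ)
lemma16 _ (ax-it γ φ)     = ax-it (parG γ) (parF φ)
lemma16 _ (ax-tst ψ φ)    = ax-tst (parF ψ) (parF φ)
lemma16 _ (ax-dual γ φ)   = ax-dual (parG γ) (parF φ)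
lemma16 _ (ax-dch γ δ φ)  = ⊓-axiom (parG γ) (parG δ) (parF φ)
lemma16 _ (ax-dit γ φ)    = ×-axiom (parG γ) (parF φ)
lemma16 _ (ax-dtst ψ φ)   = !-axiom (parF ψ) (parF φ)
lemma16 _ (mp d e)        = mp (lemma16 _ d) (lemma16 _ e)
lemma16 _ (mono γ d)      = mono (parG γ) (lemma16 _ d)
lemma16 _ (bar γ d)       = bar (parG γ) (lemma16 _ d)
lemma16 _ (dbar γ d)      = ×-induction (parG γ) (lemma16 _ d)
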